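{- Let $s,k,d$ be natural numbers and $\nu$ a real number with $2d/k<\nu<1$. Let $r=\binom{k+d}{d}-1$ and $K=\frac{d}{d+1}(r+1)k$. Then there is a positive number $\eta=\eta(d,k)$ such that, whenever $s\le\frac{d}{2d+2}(1-\nu)r(k+1)$, one has $J_{s,k,d}(X)\gg X^{2sd-K+\eta}$.
   Context: For $\mathbf{x}\in\mathbb{Z}^d$ and $\mathbf{i}$ a $d$-tuple of non-negative integers, $\mathbf{x}^{\mathbf{i}}=x_1^{i_1}\cdots x_d^{i_d}$, $|\mathbf{i}|=i_1+\dots+i_d$. $J_{s,k,d}(X)$ denotes the number of integral solutions of $\sum_{j=1}^s\mathbf{x}_j^{\mathbf{i}}=\sum_{j=1}^s\mathbf{y}_j^{\mathbf{i}}$ $(1\le|\mathbf{i}|\le k)$ with $\mathbf{x}_j,\mathbf{y}_j\in\mathbb{Z}^d$ having all coordinates in $[1,X]$.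
   Formalization: The parameter ν ranges over the rationals rather than the reals, and the positive number η is taken in the rationals. -}

module Defs where

open import Data.Bool using (Bool; true; false; _∧_; if_then_else_)
open import Data.Nat as ℕ using (ℕ; zero; suc; _+_; _*_; _^_; _≤_; _≡ᵇ_; _≤ᵇ_)
open import Data.Nat.Combinatorics using (_C_)
open import Data.Integer as ℤ using (ℤ; +_; -[1+_])
open import Data.Rational as ℚ using (ℚ; _/_)
open import Data.List as List using (List; []; _∷_; upTo; concatMap)
open import Data.Product using (Σ; _×_)
open import Data.Vec as Vec using (Vec; []; _∷_)

vecsOver : {A : Set} (n : ℕ) → List A → List (Vec A n)
vecsOver zero    xs = [] ∷ []
vecsOver (suc n) xs = concatMap (λ v → List.map (λ a → a ∷ v) xs) (vecsOver n xs)

boxPoints : (d X : ℕ) → List (Vec ℕ d)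
boxPoints d X = vecsOver d (List.map suc (upTo X))

vsum : {n : ℕ} → Vec ℕ n → ℕ
vsum = Vec.foldr _ _+_ 0

multiIndices : (k d : ℕ) → List (Vec ℕ d)
multiIndices k d =
  List.filterᵇ (λ i → (1 ≤ᵇ vsum i) ∧ (vsum i ≤ᵇ k)) (vecsOver d (upTo (suc k)))

mono : {d : ℕ} → Vec ℕ d → Vec ℕ d → ℕ
mono x i = Vec.foldr _ _*_ 1 (Vec.zipWith _^_ x i)

powerSum : {s d : ℕ} → Vec (Vec ℕ d) s → Vec ℕ d → ℕ
powerSum xs i = vsum (Vec.map (λ x → mono x i) xs)

allB : {A : Set} → (A → Bool) → List A → Bool
allB p []       = true
allB p (a ∷ as) = p a ∧ allB p as

count : {A : Set} → (A → Bool) → List A → ℕ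
count p []       = 0
count p (a ∷ as) = if p a then suc (count p as) else count p as

isSolution : (s k d : ℕ) → Vec (Vec ℕ d) s → Vec (Vec ℕ d) s → Bool
isSolution s k d xs ys = allB (λ i → powerSum xs i ≡ᵇ powerSum ys i) (multiIndices k d)

J : (s k d X : ℕ) → ℕ
J s k d X =
  List.foldr _+_ 0 (List.map (λ xs → count (isSolution s k d xs) tuples) tuples)
  where
  tuples : List (Vec (Vec ℕ d) s)
  tuples = vecsOver s (boxPoints d X)

⟦_⟧ : ℕ → ℚ
⟦ n ⟧ = + n / 1

rr : (k d : ℕ) → ℚ
rr k d = ⟦ (k + d) C d ⟧ ℚ.- ℚ.1ℚ

KK : (k d : ℕ) → ℚ
KK k d = ((+ d) / suc d) ℚ.* (rr k d ℚ.+ ℚ.1ℚ) ℚ.* ⟦ k ⟧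

-- f(X) ≫ X^a  (for X ≥ 1): there is C ≥ 1 with f(X) ≥ C^{-1/q} X^{p/q}
-- for all X ≥ 1, where a = p/q in lowest terms; stated in integers as
--  X^p ≤ C f(X)^q (p ≥ 0)   or   1 ≤ C f(X)^q X^{m+1} (p = -(m+1)).
powBound : ℕ → ℕ → ℕ → ℤ → ℕ → Set
powBound c q X (+ p)      fX = X ^ p ≤ c * fX ^ q
powBound c q X -[1+ m ]   fX = 1 ≤ c * fX ^ q * X ^ suc m

_≫X^_ : (ℕ → ℕ) → ℚ → Set
f ≫X^ a = Σ ℕ λ c → (1 ≤ c) × ((X : ℕ) → 1 ≤ X →
  powBound c (ℚ.denominatorℕ a) X (ℚ.numerator a) (f X))

-- Put 1 in the first coordinate of every point.  For a multi-index (j, i) with |i| = 0 both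
-- sides of the equation are then s, and otherwise the equation is the one for i in dimension
-- d − 1, so every solution of the (d − 1)-dimensional system lifts to dimension d.  The X^{(d−1)s}
-- tuples in dimension d − 1 have their power sums in a box of at most ((s + 1) X^k)^L points,
-- where L = #{i : 1 ≤ |i| ≤ k} in dimension d − 1, and Cauchy–Schwarz over the fibres gives
-- X^{2(d−1)s} ≤ (s + 1)^L X^{kL} J_{s,k,d}(X).  As L + 1 = C(k + d − 1, d − 1), d (r + 1) = (k + d)(L + 1),
-- and with η = 1/((d + 1) k) the remaining inequality 2sd − K + η + kL ≤ 2(d − 1)s becomes, under
-- the hypotheses on s and ν, a polynomial inequality in d, k − 2d and L.

module Submission where

open import Defs

module Counting where

  open import Data.Bool using (Bool; true; false; if_then_else_; T; _∧_)
  open import Data.Bool.Properties using (T?; T-∧)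
  open import Data.List as List using (List; []; _∷_; _++_; map; concatMap; length; filter; filterᵇ; upTo)
  open import Data.List.Properties using (length-map; length-upTo; map-applyUpTo)
  open import Data.List.Membership.Propositional using (_∈_; find; lose)
  open import Data.List.Membership.Propositional.Properties
    using (∈-map⁺; ∈-map⁻; ∈-concatMap⁺; ∈-concatMap⁻; ∈-filter⁺; ∈-filter⁻; ∈-upTo⁺; ∈-upTo⁻)
  open import Data.List.Relation.Binary.Sublist.Heterogeneous using (Sublist; []; _∷_; _∷ʳ_)
  import Data.List.Relation.Binary.Sublist.Heterogeneous as Sublist
  open import Data.List.Relation.Binary.Sublist.Heterogeneous.Properties using (map⁺; concat⁺; ++ˡ)
  open import Data.List.Relation.Unary.All as All using (All; []; _∷_)
  import Data.List.Relation.Unary.All.Properties as All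
  open import Data.List.Relation.Unary.Any using (here; there)
  open import Data.Nat
  open import Data.Nat.Combinatorics using (_C_; nCn≡1; nC1≡n; nCk+nC[k+1]≡[n+1]C[k+1]; k>n⇒nCk≡0)
  open import Data.Nat.Properties
  open import Data.Nat.Tactic.RingSolver using (solve-∀)
  open import Data.Product using (Σ; _×_; _,_; proj₂)
  open import Data.Sum using (inj₁; inj₂)
  open import Data.Vec as Vec using (Vec; []; _∷_)
  import Data.Vec.Properties as Vec
  open import Data.Vec.Relation.Unary.All as VAll using () renaming (All to VAll; [] to []ᵛ; _∷_ to _∷ᵛ_)
  open import Function using (id; _∘_; Equivalence)
  open import Relation.Binary.Definitions using (DecidableEquality)
  open import Relation.Binary.PropositionalEquality hiding (J)
  open import Relation.Nullary using (¬_; yes; no; does; contradiction)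
  open import Relation.Nullary.Decidable using (dec-true)
  open import Relation.Unary using (Decidable)
  open import Relation.Unary.Properties using (∁?)

  private variable
    A B : Set
    s d : ℕ

  𝟙 : Bool → ℕ
  𝟙 b = if b then 1 else 0

  ∑ : List A → (A → ℕ) → ℕ
  ∑ []       f = 0
  ∑ (x ∷ xs) f = f x + ∑ xs f

  syntax ∑ xs (λ x → e) = ∑[ x ∈ xs ] e

  ∑-cong : (xs : List A) {f g : A → ℕ} → (∀ x → f x ≡ g x) → ∑ xs f ≡ ∑ xs g
  ∑-cong []       f≗g = refl
  ∑-cong (x ∷ xs) f≗g = cong₂ _+_ (f≗g x) (∑-cong xs f≗g)

  ∑-mono-≤ : (xs : List A) {f g : A → ℕ} → (∀ x → f x ≤ g x) → ∑ xs f ≤ ∑ xs g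
  ∑-mono-≤ []       f≤g = z≤n
  ∑-mono-≤ (x ∷ xs) f≤g = +-mono-≤ (f≤g x) (∑-mono-≤ xs f≤g)

  ∑-const : (xs : List A) (c : ℕ) → ∑[ _ ∈ xs ] c ≡ length xs * c
  ∑-const []       c = refl
  ∑-const (x ∷ xs) c = cong (c +_) (∑-const xs c)

  ∑-distrib-+ : (xs : List A) (f g : A → ℕ) → ∑[ x ∈ xs ] (f x + g x) ≡ ∑ xs f + ∑ xs g
  ∑-distrib-+ []       f g = refl
  ∑-distrib-+ (x ∷ xs) f g = begin
    f x + g x + ∑[ x ∈ xs ] (f x + g x) ≡⟨ cong (f x + g x +_) (∑-distrib-+ xs f g) ⟩
    f x + g x + (∑ xs f + ∑ xs g)       ≡⟨ +-exchange (f x) (g x) (∑ xs f) (∑ xs g) ⟩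
    f x + ∑ xs f + (g x + ∑ xs g)       ∎
    where
    open ≡-Reasoning
    +-exchange : ∀ a b c d → a + b + (c + d) ≡ a + c + (b + d)
    +-exchange = solve-∀

  ∑-swap : (xs : List A) (ys : List B) (f : A → B → ℕ) →
           ∑[ x ∈ xs ] ∑[ y ∈ ys ] f x y ≡ ∑[ y ∈ ys ] ∑[ x ∈ xs ] f x y
  ∑-swap []       ys f = sym (trans (∑-const ys 0) (*-zeroʳ (length ys)))
  ∑-swap (x ∷ xs) ys f = trans (cong (∑ ys (f x) +_) (∑-swap xs ys f))
                               (sym (∑-distrib-+ ys (f x) (λ y → ∑[ x ∈ xs ] f x y)))

  ∑-++ : (xs ys : List A) (f : A → ℕ) → ∑ (xs ++ ys) f ≡ ∑ xs f + ∑ ys f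
  ∑-++ []       ys f = refl
  ∑-++ (x ∷ xs) ys f = trans (cong (f x +_) (∑-++ xs ys f)) (sym (+-assoc (f x) _ _))

  ∑-map : (g : A → B) (xs : List A) (f : B → ℕ) → ∑ (map g xs) f ≡ ∑ xs (f ∘ g)
  ∑-map g []       f = refl
  ∑-map g (x ∷ xs) f = cong (f (g x) +_) (∑-map g xs f)

  ∑-concatMap : (g : A → List B) (xs : List A) (f : B → ℕ) →
                ∑ (concatMap g xs) f ≡ ∑[ x ∈ xs ] ∑ (g x) f
  ∑-concatMap g []       f = refl
  ∑-concatMap g (x ∷ xs) f = trans (∑-++ (g x) (concatMap g xs) f) (cong (∑ (g x) f +_) (∑-concatMap g xs f))

  length≡∑1 : (xs : List A) → length xs ≡ ∑[ _ ∈ xs ] 1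
  length≡∑1 []       = refl
  length≡∑1 (x ∷ xs) = cong suc (length≡∑1 xs)

  length-concatMap : (g : A → List B) (xs : List A) → length (concatMap g xs) ≡ ∑[ x ∈ xs ] length (g x)
  length-concatMap g xs = begin
    length (concatMap g xs)         ≡⟨ length≡∑1 (concatMap g xs) ⟩
    ∑[ _ ∈ concatMap g xs ] 1        ≡⟨ ∑-concatMap g xs (λ _ → 1) ⟩
    ∑[ x ∈ xs ] ∑[ _ ∈ g x ] 1       ≡⟨ ∑-cong xs (sym ∘ length≡∑1 ∘ g) ⟩
    ∑[ x ∈ xs ] length (g x)         ∎
    where open ≡-Reasoning

  ∑-mono-Sublist : {φ : A → B} {xs : List A} {ys : List B} (f : B → ℕ) →
                   Sublist (λ x y → φ x ≡ y) xs ys → ∑ xs (f ∘ φ) ≤ ∑ ys f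
  ∑-mono-Sublist f []          = z≤n
  ∑-mono-Sublist f (y ∷ʳ xs⊆ys) = ≤-trans (∑-mono-Sublist f xs⊆ys) (m≤n+m _ (f y))
  ∑-mono-Sublist f (refl ∷ xs⊆ys) = +-monoʳ-≤ _ (∑-mono-Sublist f xs⊆ys)

  ∑-partition : {P : A → Set} (P? : Decidable P) (xs : List A) (h : A → ℕ) →
                ∑ xs h ≡ ∑ (filter P? xs) h + ∑ (filter (∁? P?) xs) h
  ∑-partition P? []       h = refl
  ∑-partition P? (x ∷ xs) h with P? x
  ... | yes _ = trans (cong (h x +_) (∑-partition P? xs h)) (sym (+-assoc (h x) (∑ (filter P? xs) h) _))
  ... | no  _ = trans (cong (h x +_) (∑-partition P? xs h)) (+-exchange (h x) (∑ (filter P? xs) h) _)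
    where
    +-exchange : ∀ a b c → a + (b + c) ≡ b + (a + c)
    +-exchange = solve-∀

  ∑-All-const : {U : List A} {g : A → ℕ} {c : ℕ} → All (λ y → g y ≡ c) U → ∑ U g ≡ length U * c
  ∑-All-const []           = refl
  ∑-All-const (gy≡c ∷ all) = cong₂ _+_ gy≡c (∑-All-const all)

  -- Cauchy–Schwarz for the number of collisions of a map

  private
    2mn≤m²+n²-ordered : ∀ {m n} → m ≤ n → 2 * (m * n) ≤ m * m + n * n
    2mn≤m²+n²-ordered {m} {n} m≤n with n ∸ m | m+[n∸m]≡n m≤n
    ... | t | refl = subst (2 * (m * (m + t)) ≤_) (square-gap m t) (m≤m+n _ (t * t))
      where
      square-gap : ∀ m t → 2 * (m * (m + t)) + t * t ≡ m * m + (m + t) * (m + t)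
      square-gap = solve-∀

  2mn≤m²+n² : ∀ m n → 2 * (m * n) ≤ m * m + n * n
  2mn≤m²+n² m n with ≤-total m n
  ... | inj₁ m≤n = 2mn≤m²+n²-ordered m≤n
  ... | inj₂ n≤m = subst₂ _≤_ (cong (2 *_) (*-comm n m)) (+-comm (n * n) (m * m)) (2mn≤m²+n²-ordered n≤m)

  ^-distribʳ-* : ∀ m n o → (m * n) ^ o ≡ m ^ o * n ^ o
  ^-distribʳ-* m n zero    = refl
  ^-distribʳ-* m n (suc o) = trans (cong (m * n *_) (^-distribʳ-* m n o)) (interchange m n (m ^ o) (n ^ o))
    where
    interchange : ∀ a b c d → a * b * (c * d) ≡ a * c * (b * d)
    interchange = solve-∀

  cauchy-schwarz₂ : ∀ m a b J → b * b ≤ m * J → (a + b) * (a + b) ≤ suc m * (a * a + J)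
  cauchy-schwarz₂ zero a zero J _
    rewrite +-identityʳ a | +-identityʳ (a * a + J) = m≤m+n (a * a) J
  cauchy-schwarz₂ zero a (suc b) J ()
  cauchy-schwarz₂ m@(suc _) a b J b²≤mJ = *-cancelˡ-≤ m (begin
    m * ((a + b) * (a + b))                                  ≡⟨ expand m a b ⟩
    m * (a * a) + 2 * ((m * a) * b) + m * (b * b)            ≤⟨ +-monoˡ-≤ (m * (b * b)) (+-monoʳ-≤ (m * (a * a)) (2mn≤m²+n² (m * a) b)) ⟩
    m * (a * a) + ((m * a) * (m * a) + b * b) + m * (b * b)  ≡⟨ regroup m a b ⟩
    m * (suc m * (a * a)) + suc m * (b * b)                  ≤⟨ +-monoʳ-≤ (m * (suc m * (a * a))) (*-monoʳ-≤ (suc m) b²≤mJ) ⟩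
    m * (suc m * (a * a)) + suc m * (m * J)                  ≡⟨ factor m a J ⟩
    m * (suc m * (a * a + J))                                ∎)
    where
    open ≤-Reasoning
    expand : ∀ m a b → m * ((a + b) * (a + b)) ≡ m * (a * a) + 2 * ((m * a) * b) + m * (b * b)
    expand = solve-∀
    regroup : ∀ m a b → m * (a * a) + ((m * a) * (m * a) + b * b) + m * (b * b) ≡ m * (suc m * (a * a)) + suc m * (b * b)
    regroup = solve-∀
    factor : ∀ m a J → m * (suc m * (a * a)) + suc m * (m * J) ≡ m * (suc m * (a * a + J))
    factor = solve-∀

  module Collisions {B : Set} (_≟_ : DecidableEquality B) (f : A → B) where

    agree : A → A → ℕ
    agree x y = 𝟙 (does (f x ≟ f y))

    collisions : List A → ℕ
    collisions T = ∑[ x ∈ T ] ∑[ y ∈ T ] agree x y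

    collisions-partition : {P : A → Set} (P? : Decidable P) (T : List A) →
      collisions (filter P? T) + collisions (filter (∁? P?) T) ≤ collisions T
    collisions-partition P? T = begin
      ∑[ x ∈ T₁ ] ∑ T₁ (agree x) + ∑[ x ∈ T₂ ] ∑ T₂ (agree x)
        ≤⟨ +-mono-≤ (∑-mono-≤ T₁ (λ x → ≤-trans (m≤m+n _ _) (≤-reflexive (sym (split x)))))
                    (∑-mono-≤ T₂ (λ x → ≤-trans (m≤n+m _ _) (≤-reflexive (sym (split x))))) ⟩
      ∑[ x ∈ T₁ ] ∑ T (agree x) + ∑[ x ∈ T₂ ] ∑ T (agree x)
        ≡⟨ ∑-partition P? T (λ x → ∑ T (agree x)) ⟨
      collisions T ∎
      where
      open ≤-Reasoning
      T₁ = filter P? T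
      T₂ = filter (∁? P?) T
      split : ∀ x → ∑ T (agree x) ≡ ∑ T₁ (agree x) + ∑ T₂ (agree x)
      split x = ∑-partition P? T (agree x)

    collisions-fibre : ∀ {v} {U : List A} → All (λ x → f x ≡ v) U → collisions U ≡ length U * length U
    collisions-fibre {U = U} fU≡v = ∑-All-const (All.map row fU≡v)
      where
      row : ∀ {x} → f x ≡ _ → ∑ U (agree x) ≡ length U
      row fx≡v = trans (∑-All-const (All.map (λ fy≡v → cong 𝟙 (dec-true (_ ≟ _) (trans fx≡v (sym fy≡v)))) fU≡v))
                       (*-identityʳ (length U))

    collisions-bound : (V : List B) (T : List A) → All (λ x → f x ∈ V) T →
                       length T * length T ≤ length V * collisions T
    collisions-bound []      []       []  = z≤n
    collisions-bound (v ∷ V) T        fT∈ = begin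
      length T * length T                                ≡⟨ cong (λ n → n * n) |T|≡a+b ⟩
      (a + b) * (a + b)                                  ≤⟨ cauchy-schwarz₂ (length V) a b _ (collisions-bound V T₂ fT₂∈V) ⟩
      suc (length V) * (a * a + collisions T₂)           ≡⟨ cong (λ c → suc (length V) * (c + collisions T₂)) (collisions-fibre (All.all-filter P? T)) ⟨
      suc (length V) * (collisions T₁ + collisions T₂)   ≤⟨ *-monoʳ-≤ (suc (length V)) (collisions-partition P? T) ⟩
      suc (length V) * collisions T                      ∎
      where
      open ≤-Reasoning
      P? = λ x → f x ≟ v
      T₁ = filter P? T
      T₂ = filter (∁? P?) T
      a = length T₁
      b = length T₂
      |T|≡a+b : length T ≡ a + b
      |T|≡a+b = trans (length≡∑1 T) (trans (∑-partition P? T (λ _ → 1)) (sym (cong₂ _+_ (length≡∑1 T₁) (length≡∑1 T₂))))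
      fT₂∈V : All (λ x → f x ∈ V) T₂
      fT₂∈V = All.zipWith drop-v (All.filter⁺ (∁? P?) fT∈ , All.all-filter (∁? P?) T)
        where
        drop-v : ∀ {x} → (f x ∈ v ∷ V) × (¬ f x ≡ v) → f x ∈ V
        drop-v (here fx≡v  , fx≢v) = contradiction fx≡v fx≢v
        drop-v (there fx∈V , _)    = fx∈V

  length-vecsOver : (n : ℕ) (xs : List A) → length (vecsOver n xs) ≡ length xs ^ n
  length-vecsOver zero    xs = refl
  length-vecsOver (suc n) xs = begin
    length (concatMap (λ v → map (_∷ v) xs) (vecsOver n xs)) ≡⟨ length-concatMap (λ v → map (_∷ v) xs) (vecsOver n xs) ⟩
    ∑[ v ∈ vecsOver n xs ] length (map (_∷ v) xs)          ≡⟨ ∑-cong (vecsOver n xs) (λ v → length-map (_∷ v) xs) ⟩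
    ∑[ _ ∈ vecsOver n xs ] length xs                        ≡⟨ ∑-const (vecsOver n xs) (length xs) ⟩
    length (vecsOver n xs) * length xs                       ≡⟨ cong (_* length xs) (length-vecsOver n xs) ⟩
    length xs ^ n * length xs                                ≡⟨ *-comm (length xs ^ n) (length xs) ⟩
    length xs ^ suc n                                        ∎
    where open ≡-Reasoning

  ∈-vecsOver⁻ : {n : ℕ} {xs : List A} {v : Vec A n} → v ∈ vecsOver n xs → VAll (_∈ xs) v
  ∈-vecsOver⁻ {n = zero}  {v = []}    _ = []ᵛ
  ∈-vecsOver⁻ {n = suc n} {xs} {v = a ∷ v} a∷v∈ with find (∈-concatMap⁻ (λ w → map (_∷ w) xs) {xs = vecsOver n xs} a∷v∈)
  ... | w , w∈ , a∷v∈a∷w with ∈-map⁻ (_∷ w) a∷v∈a∷w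
  ...   | b , b∈xs , refl = b∈xs ∷ᵛ ∈-vecsOver⁻ w∈

  ∈-vecsOver⁺ : {n : ℕ} {xs : List A} {v : Vec A n} → VAll (_∈ xs) v → v ∈ vecsOver n xs
  ∈-vecsOver⁺ []ᵛ              = here refl
  ∈-vecsOver⁺ (a∈xs ∷ᵛ v∈xsⁿ) = ∈-concatMap⁺ (λ w → map (_∷ w) _) (lose (∈-vecsOver⁺ v∈xsⁿ) (∈-map⁺ _ a∈xs))

  vecsOver-mono : {φ : A → B} {xs : List A} {ys : List B} (n : ℕ) →
    Sublist (λ x y → φ x ≡ y) xs ys → Sublist (λ v w → Vec.map φ v ≡ w) (vecsOver n xs) (vecsOver n ys)
  vecsOver-mono zero    xs⊆ys = refl ∷ []
  vecsOver-mono {φ = φ} (suc n) xs⊆ys =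
    concat⁺ (map⁺ _ _ (Sublist.map extend (vecsOver-mono n xs⊆ys)))
    where
    extend : ∀ {v w} → Vec.map φ v ≡ w → Sublist (λ u u′ → Vec.map φ u ≡ u′) (map (_∷ v) _) (map (_∷ w) _)
    extend refl = map⁺ _ _ (Sublist.map (cong (_∷ _)) xs⊆ys)

  -- Lifting solutions from dimension d − 1

  count≡∑ : (p : A → Bool) (xs : List A) → count p xs ≡ ∑[ x ∈ xs ] 𝟙 (p x)
  count≡∑ p []       = refl
  count≡∑ p (x ∷ xs) with p x
  ... | true  = cong suc (count≡∑ p xs)
  ... | false = count≡∑ p xs

  foldr-+≡∑ : (xs : List ℕ) → List.foldr _+_ 0 xs ≡ ∑[ x ∈ xs ] x
  foldr-+≡∑ []       = refl
  foldr-+≡∑ (x ∷ xs) = cong (x +_) (foldr-+≡∑ xs)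

  J≡∑ : ∀ s k d X → let tuples = vecsOver s (boxPoints d X) in
        J s k d X ≡ ∑[ xs ∈ tuples ] ∑[ ys ∈ tuples ] 𝟙 (isSolution s k d xs ys)
  J≡∑ s k d X = begin
    List.foldr _+_ 0 (map (λ xs → count (isSolution s k d xs) tuples) tuples) ≡⟨ foldr-+≡∑ (map (λ xs → count (isSolution s k d xs) tuples) tuples) ⟩
    ∑[ c ∈ map (λ xs → count (isSolution s k d xs) tuples) tuples ] c         ≡⟨ ∑-map _ tuples (λ c → c) ⟩
    ∑[ xs ∈ tuples ] count (isSolution s k d xs) tuples                       ≡⟨ ∑-cong tuples (λ xs → count≡∑ (isSolution s k d xs) tuples) ⟩
    ∑[ xs ∈ tuples ] ∑[ ys ∈ tuples ] 𝟙 (isSolution s k d xs ys)             ∎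
    where
    open ≡-Reasoning
    tuples = vecsOver s (boxPoints d X)

  allB-true : (p : A → Bool) (xs : List A) → (∀ {x} → x ∈ xs → T (p x)) → allB p xs ≡ true
  allB-true p []       _   = refl
  allB-true p (x ∷ xs) all with p x | all (here refl)
  ... | true | _ = allB-true p xs (all ∘ there)

  lift : Vec (Vec ℕ d) s → Vec (Vec ℕ (suc d)) s
  lift = Vec.map (1 ∷_)

  powerSum-lift : (xs : Vec (Vec ℕ d) s) (j : ℕ) (i : Vec ℕ d) → powerSum (lift xs) (j ∷ i) ≡ powerSum xs i
  powerSum-lift []       j i = refl
  powerSum-lift (x ∷ xs) j i =
    cong₂ _+_ (trans (cong (_* mono x i) (^-zeroˡ j)) (*-identityˡ (mono x i))) (powerSum-lift xs j i)

  mono-zero : (x i : Vec ℕ d) → vsum i ≡ 0 → mono x i ≡ 1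
  mono-zero []      []           _     = refl
  mono-zero (a ∷ x) (zero ∷ i)  |i|≡0 = trans (+-identityʳ (mono x i)) (mono-zero x i |i|≡0)
  mono-zero (a ∷ x) (suc j ∷ i) ()

  powerSum-zero : (xs : Vec (Vec ℕ d) s) (i : Vec ℕ d) → vsum i ≡ 0 → powerSum xs i ≡ s
  powerSum-zero []       i _     = refl
  powerSum-zero (x ∷ xs) i |i|≡0 = cong₂ _+_ (mono-zero x i |i|≡0) (powerSum-zero xs i |i|≡0)

  mono-≤ : ∀ {X} (x i : Vec ℕ d) → VAll (_≤ X) x → mono x i ≤ X ^ vsum i
  mono-≤         []      []      []ᵛ           = ≤-refl
  mono-≤ {X = X} (a ∷ x) (j ∷ i) (a≤X ∷ᵛ x≤X) = begin
    a ^ j * mono x i      ≤⟨ *-mono-≤ (^-monoˡ-≤ j a≤X) (mono-≤ x i x≤X) ⟩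
    X ^ j * X ^ vsum i    ≡⟨ ^-distribˡ-+-* X j (vsum i) ⟨
    X ^ (j + vsum i)      ∎
    where open ≤-Reasoning

  powerSum-≤ : ∀ {X} (xs : Vec (Vec ℕ d) s) (i : Vec ℕ d) → VAll (VAll (_≤ X)) xs → powerSum xs i ≤ s * X ^ vsum i
  powerSum-≤ []       i []ᵛ              = z≤n
  powerSum-≤ (x ∷ xs) i (x≤X ∷ᵛ xs≤X) = +-mono-≤ (mono-≤ x i x≤X) (powerSum-≤ xs i xs≤X)

  ∈-boxPoints⁻ : ∀ {X} {x : Vec ℕ d} → x ∈ boxPoints d X → VAll (_≤ X) x
  ∈-boxPoints⁻ x∈ = VAll.map coordinate≤ (∈-vecsOver⁻ x∈)
    where
    coordinate≤ : ∀ {X a} → a ∈ map suc (upTo X) → a ≤ X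
    coordinate≤ a∈ with ∈-map⁻ suc a∈
    ... | b , b∈ , refl = ∈-upTo⁻ b∈

  ∈-multiIndices⁻ : ∀ {k} {i : Vec ℕ d} → i ∈ multiIndices k d →
                    i ∈ vecsOver d (upTo (suc k)) × 1 ≤ vsum i × vsum i ≤ k
  ∈-multiIndices⁻ {i = i} i∈ with ∈-filter⁻ (T? ∘ _) i∈
  ... | i∈box , range with Equivalence.to T-∧ range
  ...   | 1≤|i| , |i|≤k = i∈box , ≤ᵇ⇒≤ 1 (vsum i) 1≤|i| , ≤ᵇ⇒≤ (vsum i) _ |i|≤k

  ∈-multiIndices⁺ : ∀ {k} {i : Vec ℕ d} → i ∈ vecsOver d (upTo (suc k)) → 1 ≤ vsum i → vsum i ≤ k →
                    i ∈ multiIndices k d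
  ∈-multiIndices⁺ i∈box 1≤|i| |i|≤k = ∈-filter⁺ (T? ∘ _) i∈box (Equivalence.from T-∧ (≤⇒≤ᵇ 1≤|i| , ≤⇒≤ᵇ |i|≤k))

  powerSums : (is : List (Vec ℕ d)) → Vec (Vec ℕ d) s → Vec ℕ (length is)
  powerSums is xs = Vec.map (powerSum xs) (Vec.fromList is)

  powerSums-≡⁻ : (is : List (Vec ℕ d)) (xs ys : Vec (Vec ℕ d) s) → powerSums is xs ≡ powerSums is ys →
                 All (λ i → powerSum xs i ≡ powerSum ys i) is
  powerSums-≡⁻ []       xs ys eq = []
  powerSums-≡⁻ (i ∷ is) xs ys eq = Vec.∷-injectiveˡ eq ∷ powerSums-≡⁻ is xs ys (Vec.∷-injectiveʳ eq)

  powerSums-∈ : ∀ {B} (is : List (Vec ℕ d)) (xs : Vec (Vec ℕ d) s) → All (λ i → powerSum xs i ≤ B) is →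
                powerSums is xs ∈ vecsOver (length is) (upTo (suc B))
  powerSums-∈ is xs bounded = ∈-vecsOver⁺ (entries is bounded)
    where
    entries : ∀ {B} is → All (λ i → powerSum xs i ≤ B) is → VAll (_∈ upTo (suc B)) (powerSums is xs)
    entries []       []                  = []ᵛ
    entries (i ∷ is) (entry≤B ∷ bounded) = ∈-upTo⁺ (s≤s entry≤B) ∷ᵛ entries is bounded

  isSolution-lift : ∀ s k d (xs ys : Vec (Vec ℕ d) s) →
                    powerSums (multiIndices k d) xs ≡ powerSums (multiIndices k d) ys →
                    isSolution s k (suc d) (lift xs) (lift ys) ≡ true
  isSolution-lift s k d xs ys same = allB-true _ (multiIndices k (suc d)) agrees
    where
    agrees : ∀ {ji} → ji ∈ multiIndices k (suc d) → T (powerSum (lift xs) ji ≡ᵇ powerSum (lift ys) ji)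
    agrees {j ∷ i} ji∈ with ∈-multiIndices⁻ ji∈
    ... | j∷i∈box , _ , |ji|≤k = ≡⇒≡ᵇ _ _ (begin
      powerSum (lift xs) (j ∷ i) ≡⟨ powerSum-lift xs j i ⟩
      powerSum xs i              ≡⟨ reduced ⟩
      powerSum ys i              ≡⟨ powerSum-lift ys j i ⟨
      powerSum (lift ys) (j ∷ i) ∎)
      where
      open ≡-Reasoning
      i∈box : i ∈ vecsOver d (upTo (suc k))
      i∈box with ∈-vecsOver⁻ j∷i∈box
      ... | _ ∷ᵛ i∈ = ∈-vecsOver⁺ i∈
      reduced : powerSum xs i ≡ powerSum ys i
      reduced with vsum i ≟ 0
      ... | yes |i|≡0 = trans (powerSum-zero xs i |i|≡0) (sym (powerSum-zero ys i |i|≡0))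
      ... | no  |i|≢0 = All.lookup (powerSums-≡⁻ (multiIndices k d) xs ys same)
                          (∈-multiIndices⁺ i∈box (n≢0⇒n>0 |i|≢0) (≤-trans (m≤n+m (vsum i) j) |ji|≤k))

  box-lift : ∀ d X → Sublist (λ x y → 1 ∷ x ≡ y) (boxPoints d (suc X)) (boxPoints (suc d) (suc X))
  box-lift d X = heads (vecsOver d (map suc (upTo (suc X))))
    where
    -- the block of boxPoints (suc d) (suc X) generated by v begins with 1 ∷ v
    heads : (vs : List (Vec ℕ d)) → Sublist (λ x y → 1 ∷ x ≡ y) vs (concatMap (λ v → map (_∷ v) (map suc (upTo (suc X)))) vs)
    heads []       = []
    heads (v ∷ vs) = refl ∷ ++ˡ _ (heads vs)

  lifted-solutions≤J : ∀ s k d X → let tuples = vecsOver s (boxPoints d (suc X)) in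
    ∑[ xs ∈ tuples ] ∑[ ys ∈ tuples ] 𝟙 (isSolution s k (suc d) (lift xs) (lift ys)) ≤ J s k (suc d) (suc X)
  lifted-solutions≤J s k d X = begin
    ∑[ xs ∈ tuples ] ∑[ ys ∈ tuples ] 𝟙 (isSolution s k (suc d) (lift xs) (lift ys))
      ≤⟨ ∑-mono-≤ tuples (λ xs → ∑-mono-Sublist (λ ys → 𝟙 (isSolution s k (suc d) (lift xs) ys)) tuples⊆) ⟩
    ∑[ xs ∈ tuples ] ∑[ ys ∈ tuples′ ] 𝟙 (isSolution s k (suc d) (lift xs) ys)
      ≤⟨ ∑-mono-Sublist (λ xs → ∑[ ys ∈ tuples′ ] 𝟙 (isSolution s k (suc d) xs ys)) tuples⊆ ⟩
    ∑[ xs ∈ tuples′ ] ∑[ ys ∈ tuples′ ] 𝟙 (isSolution s k (suc d) xs ys)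
      ≡⟨ J≡∑ s k (suc d) (suc X) ⟨
    J s k (suc d) (suc X) ∎
    where
    open ≤-Reasoning
    tuples = vecsOver s (boxPoints d (suc X))
    tuples′ = vecsOver s (boxPoints (suc d) (suc X))
    tuples⊆ : Sublist (λ xs ys → lift xs ≡ ys) tuples tuples′
    tuples⊆ = vecsOver-mono s (box-lift d X)

  length-tuples : ∀ s d X → length (vecsOver s (boxPoints d X)) ≡ X ^ (d * s)
  length-tuples s d X = begin
    length (vecsOver s (boxPoints d X))    ≡⟨ length-vecsOver s (boxPoints d X) ⟩
    length (boxPoints d X) ^ s             ≡⟨ cong (_^ s) (length-vecsOver d (map suc (upTo X))) ⟩
    (length (map suc (upTo X)) ^ d) ^ s    ≡⟨ cong (λ n → (n ^ d) ^ s) (trans (length-map suc (upTo X)) (length-upTo X)) ⟩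
    (X ^ d) ^ s                            ≡⟨ ^-*-assoc X d s ⟩
    X ^ (d * s)                            ∎
    where open ≡-Reasoning

  J-lower-bound : ∀ s k D X′ → let X = suc X′ ; L = length (multiIndices k D) in
                  X ^ (D * s + D * s) ≤ suc s ^ L * X ^ (k * L) * J s k (suc D) X
  J-lower-bound s k D X′ = begin
    X ^ (D * s + D * s)                    ≡⟨ ^-distribˡ-+-* X (D * s) (D * s) ⟩
    X ^ (D * s) * X ^ (D * s)              ≡⟨ cong₂ _*_ (length-tuples s D X) (length-tuples s D X) ⟨
    length tuples * length tuples          ≤⟨ collisions-bound values tuples (All.tabulate signature∈values) ⟩
    length values * collisions tuples      ≤⟨ *-mono-≤ |values|≤ (≤-trans collisions≤lifted (lifted-solutions≤J s k D X′)) ⟩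
    (suc s * X ^ k) ^ L * J s k (suc D) X  ≡⟨ cong (_* J s k (suc D) X) (trans (^-distribʳ-* (suc s) (X ^ k) L) (cong (suc s ^ L *_) (^-*-assoc X k L))) ⟩
    suc s ^ L * X ^ (k * L) * J s k (suc D) X ∎
    where
    open ≤-Reasoning
    X = suc X′
    indices = multiIndices k D
    L = length indices
    tuples = vecsOver s (boxPoints D X)
    values = vecsOver L (upTo (suc (s * X ^ k)))
    open Collisions (Vec.≡-dec _≟_) (powerSums indices)

    signature∈values : ∀ {xs} → xs ∈ tuples → powerSums indices xs ∈ values
    signature∈values {xs} xs∈ = powerSums-∈ indices xs (All.tabulate entry≤)
      where
      entry≤ : ∀ {i} → i ∈ indices → powerSum xs i ≤ s * X ^ k
      entry≤ {i} i∈ = ≤-trans (powerSum-≤ xs i (VAll.map ∈-boxPoints⁻ (∈-vecsOver⁻ xs∈)))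
                               (*-monoʳ-≤ s (^-monoʳ-≤ X (proj₂ (proj₂ (∈-multiIndices⁻ i∈)))))

    |values|≤ : length values ≤ (suc s * X ^ k) ^ L
    |values|≤ = begin
      length values                       ≡⟨ length-vecsOver L (upTo (suc (s * X ^ k))) ⟩
      length (upTo (suc (s * X ^ k))) ^ L ≡⟨ cong (_^ L) (length-upTo (suc (s * X ^ k))) ⟩
      suc (s * X ^ k) ^ L                 ≤⟨ ^-monoˡ-≤ L (+-monoˡ-≤ (s * X ^ k) (m^n>0 X k)) ⟩
      (suc s * X ^ k) ^ L                 ∎

    agree≤solution : ∀ xs ys → agree xs ys ≤ 𝟙 (isSolution s k (suc D) (lift xs) (lift ys))
    agree≤solution xs ys with Vec.≡-dec _≟_ (powerSums indices xs) (powerSums indices ys)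
    ... | yes same rewrite isSolution-lift s k D xs ys same = ≤-refl
    ... | no  _    = z≤n

    collisions≤lifted : collisions tuples ≤ ∑[ xs ∈ tuples ] ∑[ ys ∈ tuples ] 𝟙 (isSolution s k (suc D) (lift xs) (lift ys))
    collisions≤lifted = ∑-mono-≤ tuples (λ xs → ∑-mono-≤ tuples (agree≤solution xs))

  -- Counting multi-indices

  ∑-upTo-suc : ∀ n (h : ℕ → ℕ) → ∑ (upTo (suc n)) h ≡ h 0 + ∑[ a ∈ upTo n ] h (suc a)
  ∑-upTo-suc n h = cong (h 0 +_) (trans (cong (λ as → ∑ as h) (sym (map-applyUpTo id suc n))) (∑-map suc (upTo n) h))

  module HockeyStick (D n : ℕ) (G : ℕ → ℕ → ℕ)
    (G-shift : ∀ t a → G (suc t) (suc a) ≡ G t a)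
    (G-empty : ∀ a → G 0 (suc a) ≡ 0)
    (G-base : ∀ {t} → t ≤ n → G t 0 ≡ (t + D) C D) where

    ∑G≡binomial : ∀ t m → t ≤ m → m ≤ n → ∑ (upTo (suc m)) (G t) ≡ (t + suc D) C suc D
    ∑G≡binomial zero m _ m≤n = begin
      ∑ (upTo (suc m)) (G 0)                  ≡⟨ ∑-upTo-suc m (G 0) ⟩
      G 0 0 + ∑[ a ∈ upTo m ] G 0 (suc a)     ≡⟨ cong₂ _+_ (G-base z≤n) (trans (∑-cong (upTo m) G-empty) (trans (∑-const (upTo m) 0) (*-zeroʳ (length (upTo m))))) ⟩
      D C D + 0                               ≡⟨ trans (+-identityʳ (D C D)) (trans (nCn≡1 D) (sym (nCn≡1 (suc D)))) ⟩
      suc D C suc D                           ∎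
      where open ≡-Reasoning
    ∑G≡binomial (suc t) zero    ()        _
    ∑G≡binomial (suc t) (suc m) (s≤s t≤m) m≤n = begin
      ∑ (upTo (suc (suc m))) (G (suc t))                     ≡⟨ ∑-upTo-suc (suc m) (G (suc t)) ⟩
      G (suc t) 0 + ∑[ a ∈ upTo (suc m) ] G (suc t) (suc a)  ≡⟨ cong₂ _+_ (G-base (≤-trans (s≤s t≤m) m≤n)) (∑-cong (upTo (suc m)) (G-shift t)) ⟩
      (suc t + D) C D + ∑ (upTo (suc m)) (G t)               ≡⟨ cong ((suc t + D) C D +_) (∑G≡binomial t m t≤m (≤-trans (n≤1+n m) m≤n)) ⟩
      (suc t + D) C D + (t + suc D) C suc D                  ≡⟨ cong (λ n → (suc t + D) C D + n C suc D) (+-suc t D) ⟩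
      (suc t + D) C D + (suc t + D) C suc D                  ≡⟨ nCk+nC[k+1]≡[n+1]C[k+1] (suc t + D) D ⟩
      suc (suc t + D) C suc D                                ≡⟨ cong (λ n → suc n C suc D) (+-suc t D) ⟨
      (suc t + suc D) C suc D                                ∎
      where open ≡-Reasoning

  #sum≤ : (D n t : ℕ) → ℕ
  #sum≤ D n t = ∑[ v ∈ vecsOver D (upTo (suc n)) ] 𝟙 (vsum v ≤ᵇ t)

  suc≤ᵇsuc : ∀ m n → (suc m ≤ᵇ suc n) ≡ (m ≤ᵇ n)
  suc≤ᵇsuc zero    n = refl
  suc≤ᵇsuc (suc m) n = refl

  #sum≤-binomial : ∀ D {n t} → t ≤ n → #sum≤ D n t ≡ (t + D) C D
  #sum≤-binomial zero    t≤n = refl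
  #sum≤-binomial (suc D) {n} {t} t≤n = begin
    #sum≤ (suc D) n t                               ≡⟨ ∑-concatMap (λ w → map (_∷ w) as) W _ ⟩
    ∑[ w ∈ W ] ∑ (map (_∷ w) as) below              ≡⟨ ∑-cong W (λ w → ∑-map (_∷ w) as below) ⟩
    ∑[ w ∈ W ] ∑[ a ∈ as ] 𝟙 (a + vsum w ≤ᵇ t)       ≡⟨ ∑-swap W as (λ w a → 𝟙 (a + vsum w ≤ᵇ t)) ⟩
    ∑ as (G t)                                      ≡⟨ ∑G≡binomial t n t≤n ≤-refl ⟩
    (t + suc D) C suc D                             ∎
    where
    open ≡-Reasoning
    as = upTo (suc n)
    W = vecsOver D as
    below : Vec ℕ (suc D) → ℕ
    below v = 𝟙 (vsum v ≤ᵇ t)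
    G : ℕ → ℕ → ℕ
    G t a = ∑[ w ∈ W ] 𝟙 (a + vsum w ≤ᵇ t)
    G-shift : ∀ t a → G (suc t) (suc a) ≡ G t a
    G-shift t a = ∑-cong W (λ w → cong 𝟙 (suc≤ᵇsuc (a + vsum w) t))
    G-empty : ∀ a → G 0 (suc a) ≡ 0
    G-empty a = trans (∑-const W 0) (*-zeroʳ (length W))
    open HockeyStick D n G G-shift G-empty (#sum≤-binomial D)

  length-filterᵇ : (p : A → Bool) (xs : List A) → length (filterᵇ p xs) ≡ ∑[ x ∈ xs ] 𝟙 (p x)
  length-filterᵇ p []       = refl
  length-filterᵇ p (x ∷ xs) with p x
  ... | true  = cong suc (length-filterᵇ p xs)
  ... | false = length-filterᵇ p xs

  |multiIndices|+1 : ∀ k D → length (multiIndices k D) + 1 ≡ (k + D) C D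
  |multiIndices|+1 k D = begin
    length (multiIndices k D) + 1                              ≡⟨ cong₂ _+_ (length-filterᵇ inRange box) (sym (trans (#sum≤-binomial D z≤n) (nCn≡1 D))) ⟩
    ∑[ i ∈ box ] 𝟙 (inRange i) + ∑[ i ∈ box ] 𝟙 (vsum i ≤ᵇ 0) ≡⟨ ∑-distrib-+ box (𝟙 ∘ inRange) (λ i → 𝟙 (vsum i ≤ᵇ 0)) ⟨
    ∑[ i ∈ box ] (𝟙 (inRange i) + 𝟙 (vsum i ≤ᵇ 0))            ≡⟨ ∑-cong box (λ i → split (vsum i)) ⟩
    #sum≤ D k k                                                ≡⟨ #sum≤-binomial D ≤-refl ⟩
    (k + D) C D                                                ∎
    where
    open ≡-Reasoning
    box = vecsOver D (upTo (suc k))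
    inRange : Vec ℕ D → Bool
    inRange i = (1 ≤ᵇ vsum i) ∧ (vsum i ≤ᵇ k)
    split : ∀ u → 𝟙 ((1 ≤ᵇ u) ∧ (u ≤ᵇ k)) + 𝟙 (u ≤ᵇ 0) ≡ 𝟙 (u ≤ᵇ k)
    split zero    = refl
    split (suc u) = +-identityʳ _

  [k+1]*[n+1]C[k+1]≡[n+1]*nCk : ∀ n k → suc k * (suc n C suc k) ≡ suc n * (n C k)
  [k+1]*[n+1]C[k+1]≡[n+1]*nCk zero    zero    = refl
  [k+1]*[n+1]C[k+1]≡[n+1]*nCk zero    (suc k) = trans (cong (suc (suc k) *_) (k>n⇒nCk≡0 {1} {suc (suc k)} (s≤s (s≤s z≤n)))) (*-zeroʳ (suc (suc k)))
  [k+1]*[n+1]C[k+1]≡[n+1]*nCk (suc n) zero    = trans (*-identityˡ _) (trans (nC1≡n (suc (suc n))) (sym (*-identityʳ (suc (suc n)))))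
  [k+1]*[n+1]C[k+1]≡[n+1]*nCk (suc n) (suc k) = begin
    suc (suc k) * (suc (suc n) C suc (suc k))        ≡⟨ cong (suc (suc k) *_) (nCk+nC[k+1]≡[n+1]C[k+1] (suc n) (suc k)) ⟨
    suc (suc k) * (a + b)                            ≡⟨ expand k a b ⟩
    suc k * a + a + suc (suc k) * b                  ≡⟨ cong₂ (λ x y → x + a + y) ([k+1]*[n+1]C[k+1]≡[n+1]*nCk n k) ([k+1]*[n+1]C[k+1]≡[n+1]*nCk n (suc k)) ⟩
    suc n * (n C k) + a + suc n * (n C suc k)        ≡⟨ collect n a (n C k) (n C suc k) ⟩
    suc n * (n C k + n C suc k) + a                  ≡⟨ cong (λ x → suc n * x + a) (nCk+nC[k+1]≡[n+1]C[k+1] n k) ⟩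
    suc n * a + a                                    ≡⟨ +-comm (suc n * a) a ⟩
    suc (suc n) * a                                  ∎
    where
    open ≡-Reasoning
    a = suc n C suc k
    b = suc n C suc (suc k)
    expand : ∀ k a b → suc (suc k) * (a + b) ≡ suc k * a + a + suc (suc k) * b
    expand = solve-∀
    collect : ∀ n a x y → suc n * x + a + suc n * y ≡ suc n * (x + y) + a
    collect = solve-∀

  binomial-step : ∀ k D → suc D * ((k + suc D) C suc D) ≡ (k + suc D) * (length (multiIndices k D) + 1)
  binomial-step k D rewrite +-suc k D | |multiIndices|+1 k D = [k+1]*[n+1]C[k+1]≡[n+1]*nCk (k + D) D

  binomial-suc : ∀ k D → Σ ℕ λ r → (k + suc D) C suc D ≡ suc r × suc D * suc r ≡ (k + suc D) * (length (multiIndices k D) + 1)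
  binomial-suc k D with (k + suc D) C suc D | binomial-step k D
  ... | suc r | step = r , refl , step
  ... | zero  | step with m*n≡0⇒m≡0∨n≡0 (k + suc D) (trans (sym step) (*-zeroʳ (suc D)))
  ...   | inj₁ k+d≡0 = contradiction (trans (sym (+-suc k D)) k+d≡0) 1+n≢0
  ...   | inj₂ L+1≡0 = contradiction (trans (+-comm 1 _) L+1≡0) 1+n≢0

module ExponentArithmetic where

  open import Data.Nat
  open import Data.Nat.Properties
  open import Data.Nat.Tactic.RingSolver using (solve-∀)
  open import Relation.Binary.PropositionalEquality
  open import Relation.Nullary using (contradiction)

  -- A = (k + d)(4d² + (2d − 1)e) is what remains of (k + d)k² after e(k + 1)(k + d) (see absorb);
  -- it exceeds (d + 1)k² once d ≥ 2, while for d = 1 there are no multi-indices (L = 0).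
  slack : ∀ D e L → let d = suc D ; k = 2 * d + e in (D ≡ 0 → L ≡ 0) →
          1 + suc d * (k * k) * L ≤ (k + d) * (4 * (d * d) + suc (2 * D) * e) * (L + 1)
  slack zero e L L≡0 rewrite L≡0 refl = subst (1 + 2 * ((2 + e) * (2 + e)) * 0 ≤_) (d≡1 e) (m≤m+n _ _)
    where
    d≡1 : ∀ e → 1 + 2 * ((2 + e) * (2 + e)) * 0 + (11 + 7 * e + e * e) ≡ (2 + e + 1) * (4 * 1 + 1 * e) * (0 + 1)
    d≡1 = solve-∀
  slack (suc D) e L _ = subst (1 + (3 + D) * ((2 * (2 + D) + e) * (2 * (2 + D) + e)) * L ≤_) (d≥2 D e L) (m≤m+n _ _)
    where
    d≥2 : ∀ D e L → 1 + (3 + D) * ((2 * (2 + D) + e) * (2 * (2 + D) + e)) * L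
                      + ((3 + D) * ((2 * (2 + D) + e) * (2 * (2 + D) + e)) + L + (8 * D * D * D + 44 * D * D + 80 * D + 47 + (6 * D * D + 17 * D + 10) * e + D * e * e) * (L + 1))
                    ≡ (2 * (2 + D) + e + (2 + D)) * (4 * ((2 + D) * (2 + D)) + suc (2 * (1 + D)) * e) * (L + 1)
    d≥2 = solve-∀

  -- The bound on s enters only through d r ≤ d (r + 1) = (k + d)(L + 1).
  exponent-gap : ∀ D e L r s → let d = suc D ; k = 2 * d + e in
    d * suc r ≡ (k + d) * (L + 1) → (D ≡ 0 → L ≡ 0) →
    s * ((2 + 2 * d) * k) ≤ e * (d * r * suc k) →
    s * ((2 + 2 * d) * k) + 1 + suc d * (k * k) * L ≤ d * suc r * (k * k)
  exponent-gap D e L r s binomial L≡0 bound = begin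
    s * ((2 + 2 * d) * k) + 1 + suc d * (k * k) * L          ≤⟨ +-monoˡ-≤ _ (+-monoˡ-≤ 1 (≤-trans bound r≤r+1)) ⟩
    e * suc k * (d * suc r) + 1 + suc d * (k * k) * L        ≡⟨ cong (λ n → e * suc k * n + 1 + suc d * (k * k) * L) binomial ⟩
    e * suc k * M + 1 + suc d * (k * k) * L                  ≡⟨ +-assoc (e * suc k * M) 1 _ ⟩
    e * suc k * M + (1 + suc d * (k * k) * L)                ≤⟨ +-monoʳ-≤ (e * suc k * M) (slack D e L L≡0) ⟩
    e * suc k * M + A * (L + 1)                              ≡⟨ absorb D e L ⟩
    M * (k * k)                                              ≡⟨ cong (_* (k * k)) binomial ⟨
    d * suc r * (k * k)                                      ∎
    where
    open ≤-Reasoning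
    d = suc D
    k = 2 * d + e
    M = (k + d) * (L + 1)
    A = (k + d) * (4 * (d * d) + suc (2 * D) * e)
    r≤r+1 : e * (d * r * suc k) ≤ e * suc k * (d * suc r)
    r≤r+1 = ≤-trans (*-monoʳ-≤ e (*-monoˡ-≤ (suc k) (*-monoʳ-≤ d (n≤1+n r)))) (≤-reflexive (reorder e d (suc r) (suc k)))
      where
      reorder : ∀ e d r k → e * (d * r * k) ≡ e * k * (d * r)
      reorder = solve-∀
    absorb : ∀ D e L → let d = suc D ; k = 2 * d + e in
      e * suc k * ((k + d) * (L + 1)) + (k + d) * (4 * (d * d) + suc (2 * D) * e) * (L + 1) ≡ (k + d) * (L + 1) * (k * k)
    absorb = solve-∀

  hypothesis-forces-2d≤k : ∀ D k L r s → let d = suc D in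
    1 ≤ k → d * suc r ≡ (k + d) * (L + 1) →
    s * ((2 + 2 * d) * k) + 2 * d * (d * r * suc k) ≤ k * (d * r * suc k) → 2 * d ≤ k
  hypothesis-forces-2d≤k D k L zero s 1≤k binomial _ = contradiction binomial (<⇒≢ d<M)
    where
    d<M : suc D * 1 < (k + suc D) * (L + 1)
    d<M = begin-strict
      suc D * 1             ≡⟨ *-identityʳ (suc D) ⟩
      suc D                 <⟨ m<n+m (suc D) 1≤k ⟩
      k + suc D             ≤⟨ m≤m*n (k + suc D) (L + 1) {{subst NonZero (+-comm 1 L) _}} ⟩
      (k + suc D) * (L + 1) ∎
      where open ≤-Reasoning
  hypothesis-forces-2d≤k D k L (suc r) s _ _ hyp =
    *-cancelʳ-≤ (2 * suc D) k W (≤-trans (m≤n+m (2 * suc D * W) _) hyp)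
    where
    W = suc D * suc r * suc k

  exponent-bound-ℕ : ∀ D k L r s → let d = suc D in
    1 ≤ k → d * suc r ≡ (k + d) * (L + 1) → (D ≡ 0 → L ≡ 0) →
    s * ((2 + 2 * d) * k) + 2 * d * (d * r * suc k) ≤ k * (d * r * suc k) →
    s * ((2 + 2 * d) * k) + 1 + suc d * (k * k) * L ≤ d * suc r * (k * k)
  exponent-bound-ℕ D k L r s 1≤k binomial L≡0 hyp
    with k ∸ 2 * suc D | m+[n∸m]≡n (hypothesis-forces-2d≤k D k L r s 1≤k binomial hyp)
  ... | e | refl = exponent-gap D e L r s binomial L≡0 (+-cancelˡ-≤ (2 * d * W) _ _ (begin
    2 * d * W + s * ((2 + 2 * d) * k)      ≡⟨ +-comm (2 * d * W) _ ⟩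
    s * ((2 + 2 * d) * k) + 2 * d * W      ≤⟨ hyp ⟩
    (2 * d + e) * W                        ≡⟨ *-distribʳ-+ W (2 * d) e ⟩
    2 * d * W + e * W                      ∎))
    where
    open ≤-Reasoning
    d = suc D
    W = d * r * suc k

module RationalBounds where

  open Counting using (^-distribʳ-*)
  open import Data.Integer as ℤ using (+_; -[1+_])
  import Data.Integer.Properties as ℤ
  import Data.Integer.Tactic.RingSolver as ℤ-Solver
  open import Data.Nat as ℕ using (ℕ; suc; NonZero; _^_)
  open import Data.Nat.Combinatorics using (_C_)
  import Data.Nat.Properties as ℕ
  import Data.Nat.Tactic.RingSolver as ℕ-Solver
  open import Data.Product using (_,_)
  open import Data.Rational as ℚ using (ℚ; mkℚ; _/_; _+_; _-_; _*_; -_; 0ℚ; 1ℚ; _≤_; _<_; toℚᵘ; Positive; nonNegative)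
  open import Data.Rational.Properties
  open import Data.Rational.Solver
  open +-*-Solver using (solve; _:=_; _:+_; _:*_; _:-_; con)
  open import Data.Rational.Unnormalised as ℚᵘ using (mkℚᵘ; *≡*; *≤*) renaming (_≃_ to _≃ᵘ_)
  import Data.Rational.Unnormalised.Properties as ℚᵘ
  open import Relation.Binary.PropositionalEquality

  ⟦⟧ᵘ : ∀ n → toℚᵘ ⟦ n ⟧ ≃ᵘ mkℚᵘ (+ n) 0
  ⟦⟧ᵘ n = toℚᵘ-fromℚᵘ (mkℚᵘ (+ n) 0)

  ⟦⟧-+ : ∀ m n → ⟦ m ℕ.+ n ⟧ ≡ ⟦ m ⟧ + ⟦ n ⟧
  ⟦⟧-+ m n = toℚᵘ-injective (begin
    toℚᵘ ⟦ m ℕ.+ n ⟧                  ≈⟨ ⟦⟧ᵘ (m ℕ.+ n) ⟩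
    mkℚᵘ (+ (m ℕ.+ n)) 0              ≈⟨ *≡* (trans (cong (ℤ._* + 1) (ℤ.pos-+ m n)) (unit (+ m) (+ n))) ⟩
    mkℚᵘ (+ m) 0 ℚᵘ.+ mkℚᵘ (+ n) 0    ≈⟨ ℚᵘ.+-cong (⟦⟧ᵘ m) (⟦⟧ᵘ n) ⟨
    toℚᵘ ⟦ m ⟧ ℚᵘ.+ toℚᵘ ⟦ n ⟧         ≈⟨ toℚᵘ-homo-+ ⟦ m ⟧ ⟦ n ⟧ ⟨
    toℚᵘ (⟦ m ⟧ + ⟦ n ⟧)              ∎)
    where
    open ℚᵘ.≃-Reasoning
    unit : ∀ x y → (x ℤ.+ y) ℤ.* + 1 ≡ (x ℤ.* + 1 ℤ.+ y ℤ.* + 1) ℤ.* + 1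
    unit = ℤ-Solver.solve-∀

  ⟦⟧-* : ∀ m n → ⟦ m ℕ.* n ⟧ ≡ ⟦ m ⟧ * ⟦ n ⟧
  ⟦⟧-* m n = toℚᵘ-injective (begin
    toℚᵘ ⟦ m ℕ.* n ⟧                  ≈⟨ ⟦⟧ᵘ (m ℕ.* n) ⟩
    mkℚᵘ (+ (m ℕ.* n)) 0              ≈⟨ *≡* (cong (ℤ._* + 1) (ℤ.pos-* m n)) ⟩
    mkℚᵘ (+ m) 0 ℚᵘ.* mkℚᵘ (+ n) 0    ≈⟨ ℚᵘ.*-cong (⟦⟧ᵘ m) (⟦⟧ᵘ n) ⟨
    toℚᵘ ⟦ m ⟧ ℚᵘ.* toℚᵘ ⟦ n ⟧         ≈⟨ toℚᵘ-homo-* ⟦ m ⟧ ⟦ n ⟧ ⟨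
    toℚᵘ (⟦ m ⟧ * ⟦ n ⟧)              ∎)
    where open ℚᵘ.≃-Reasoning

  ⟦⟧-mono-≤ : ∀ {m n} → m ℕ.≤ n → ⟦ m ⟧ ≤ ⟦ n ⟧
  ⟦⟧-mono-≤ {m} {n} m≤n = toℚᵘ-cancel-≤ (ℚᵘ.≤-respˡ-≃ (ℚᵘ.≃-sym (⟦⟧ᵘ m)) (ℚᵘ.≤-respʳ-≃ (ℚᵘ.≃-sym (⟦⟧ᵘ n))
    (*≤* (ℤ.*-monoʳ-≤-nonNeg (+ 1) (ℤ.+≤+ m≤n)))))

  ⟦⟧-cancel-≤ : ∀ {m n} → ⟦ m ⟧ ≤ ⟦ n ⟧ → m ℕ.≤ n
  ⟦⟧-cancel-≤ {m} {n} ⟦m⟧≤⟦n⟧ with ℚᵘ.≤-respˡ-≃ (⟦⟧ᵘ m) (ℚᵘ.≤-respʳ-≃ (⟦⟧ᵘ n) (toℚᵘ-mono-≤ ⟦m⟧≤⟦n⟧))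
  ... | *≤* m≤n = ℤ.drop‿+≤+ (subst₂ ℤ._≤_ (ℤ.*-identityʳ (+ m)) (ℤ.*-identityʳ (+ n)) m≤n)

  ⟦⟧-pos : ∀ n .{{_ : NonZero n}} → Positive ⟦ n ⟧
  ⟦⟧-pos n = normalize-pos n 1

  /-*-⟦⟧ : ∀ a b .{{_ : NonZero b}} → ((+ a) / b) * ⟦ b ⟧ ≡ ⟦ a ⟧
  /-*-⟦⟧ a (suc b) = toℚᵘ-injective (begin
    toℚᵘ ((+ a) / suc b * ⟦ suc b ⟧)          ≈⟨ toℚᵘ-homo-* ((+ a) / suc b) ⟦ suc b ⟧ ⟩
    toℚᵘ ((+ a) / suc b) ℚᵘ.* toℚᵘ ⟦ suc b ⟧  ≈⟨ ℚᵘ.*-cong (toℚᵘ-fromℚᵘ (mkℚᵘ (+ a) b)) (⟦⟧ᵘ (suc b)) ⟩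
    mkℚᵘ (+ a) b ℚᵘ.* mkℚᵘ (+ suc b) 0        ≈⟨ *≡* (trans (ℤ.*-identityʳ (+ a ℤ.* + suc b)) (cong (λ c → + a ℤ.* + suc c) (sym (ℕ.*-identityʳ b)))) ⟩
    mkℚᵘ (+ a) 0                              ≈⟨ ⟦⟧ᵘ a ⟨
    toℚᵘ ⟦ a ⟧                                ∎)
    where open ℚᵘ.≃-Reasoning

  0<1/n : ∀ n .{{_ : NonZero n}} → 0ℚ < (+ 1) / n
  0<1/n n = positive⁻¹ ((+ 1) / n) {{normalize-pos 1 n}}

  ⟦⟧-nonNeg : ∀ n → 0ℚ ≤ ⟦ n ⟧
  ⟦⟧-nonNeg n = ⟦⟧-mono-≤ {0} {n} ℕ.z≤n

  *-monoʳ-≤-⟦⟧ : ∀ n {p q} → p ≤ q → p * ⟦ n ⟧ ≤ q * ⟦ n ⟧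
  *-monoʳ-≤-⟦⟧ n = *-monoʳ-≤-nonNeg ⟦ n ⟧ {{nonNegative (⟦⟧-nonNeg n)}}

  numerator-bound : ∀ (a : ℚ) E₁ E₂ → a + ⟦ E₂ ⟧ ≤ ⟦ E₁ ⟧ →
                    ℚ.numerator a ℤ.+ + (ℚ.denominatorℕ a ℕ.* E₂) ℤ.≤ + (ℚ.denominatorℕ a ℕ.* E₁)
  numerator-bound a@(mkℚ p q _) E₁ E₂ a+E₂≤E₁
    with ℚᵘ.≤-respˡ-≃ lhs (ℚᵘ.≤-respʳ-≃ (⟦⟧ᵘ E₁) (toℚᵘ-mono-≤ a+E₂≤E₁))
    where
    lhs : toℚᵘ (a + ⟦ E₂ ⟧) ≃ᵘ mkℚᵘ p q ℚᵘ.+ mkℚᵘ (+ E₂) 0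
    lhs = ℚᵘ.≃-trans (toℚᵘ-homo-+ a ⟦ E₂ ⟧) (ℚᵘ.+-cong (ℚᵘ.≃-refl {mkℚᵘ p q}) (⟦⟧ᵘ E₂))
  ... | *≤* cross = subst₂ ℤ._≤_ lhs-form rhs-form cross
    where
    clear : ∀ x y z → (x ℤ.* + 1 ℤ.+ y ℤ.* z) ℤ.* + 1 ≡ x ℤ.+ z ℤ.* y
    clear = ℤ-Solver.solve-∀
    lhs-form : (p ℤ.* + 1 ℤ.+ + E₂ ℤ.* + suc q) ℤ.* + 1 ≡ p ℤ.+ + (suc q ℕ.* E₂)
    lhs-form = trans (clear p (+ E₂) (+ suc q)) (cong (λ n → p ℤ.+ n) (sym (ℤ.pos-* (suc q) E₂)))
    rhs-form : + E₁ ℤ.* + suc (q ℕ.* 1) ≡ + (suc q ℕ.* E₁)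
    rhs-form = trans (cong (λ n → + E₁ ℤ.* + suc n) (ℕ.*-identityʳ q))
                     (trans (sym (ℤ.pos-* E₁ (suc q))) (cong +_ (ℕ.*-comm E₁ (suc q))))

  module _ (f : ℕ → ℕ) (c E₁ E₂ : ℕ) (bound : ∀ X → suc X ^ E₁ ℕ.≤ c ℕ.* suc X ^ E₂ ℕ.* f (suc X)) where

    bound^ : ∀ q X → suc X ^ (q ℕ.* E₁) ℕ.≤ c ^ q ℕ.* f (suc X) ^ q ℕ.* suc X ^ (q ℕ.* E₂)
    bound^ q X′ = begin
      X ^ (q ℕ.* E₁)                              ≡⟨ trans (cong (X ^_) (ℕ.*-comm q E₁)) (sym (ℕ.^-*-assoc X E₁ q)) ⟩
      (X ^ E₁) ^ q                                ≤⟨ ℕ.^-monoˡ-≤ q (bound X′) ⟩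
      (c ℕ.* X ^ E₂ ℕ.* f X) ^ q                  ≡⟨ trans (^-distribʳ-* (c ℕ.* X ^ E₂) (f X) q) (cong (ℕ._* f X ^ q) (^-distribʳ-* c (X ^ E₂) q)) ⟩
      c ^ q ℕ.* (X ^ E₂) ^ q ℕ.* f X ^ q          ≡⟨ cong (λ n → c ^ q ℕ.* n ℕ.* f X ^ q) (trans (ℕ.^-*-assoc X E₂ q) (cong (X ^_) (ℕ.*-comm E₂ q))) ⟩
      c ^ q ℕ.* X ^ (q ℕ.* E₂) ℕ.* f X ^ q        ≡⟨ swap (c ^ q) (X ^ (q ℕ.* E₂)) (f X ^ q) ⟩
      c ^ q ℕ.* f X ^ q ℕ.* X ^ (q ℕ.* E₂)        ∎
      where
      open ℕ.≤-Reasoning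
      X = suc X′
      swap : ∀ a b c → a ℕ.* b ℕ.* c ≡ a ℕ.* c ℕ.* b
      swap = ℕ-Solver.solve-∀

    powBound-from : ∀ q p → p ℤ.+ + (q ℕ.* E₂) ℤ.≤ + (q ℕ.* E₁) → ∀ X → 1 ℕ.≤ X → powBound (c ^ q) q X p (f X)
    powBound-from q (+ n) n+qE₂≤qE₁ (suc X′) _ =
      ℕ.*-cancelʳ-≤ (X ^ n) (c ^ q ℕ.* f X ^ q) (X ^ (q ℕ.* E₂)) {{ℕ.m^n≢0 X (q ℕ.* E₂)}} (begin
        X ^ n ℕ.* X ^ (q ℕ.* E₂)                   ≡⟨ ℕ.^-distribˡ-+-* X n (q ℕ.* E₂) ⟨
        X ^ (n ℕ.+ q ℕ.* E₂)                       ≤⟨ ℕ.^-monoʳ-≤ X exponents ⟩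
        X ^ (q ℕ.* E₁)                             ≤⟨ bound^ q X′ ⟩
        c ^ q ℕ.* f X ^ q ℕ.* X ^ (q ℕ.* E₂)       ∎)
      where
      open ℕ.≤-Reasoning
      X = suc X′
      exponents : n ℕ.+ q ℕ.* E₂ ℕ.≤ q ℕ.* E₁
      exponents = ℤ.drop‿+≤+ (subst (ℤ._≤ + (q ℕ.* E₁)) (sym (ℤ.pos-+ n (q ℕ.* E₂))) n+qE₂≤qE₁)
    powBound-from q -[1+ m ] qE₂≤qE₁+m+1 (suc X′) _ =
      ℕ.*-cancelʳ-≤ 1 (c ^ q ℕ.* f X ^ q ℕ.* X ^ suc m) (X ^ (q ℕ.* E₂)) {{ℕ.m^n≢0 X (q ℕ.* E₂)}} (begin
        1 ℕ.* X ^ (q ℕ.* E₂)                                 ≡⟨ ℕ.*-identityˡ _ ⟩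
        X ^ (q ℕ.* E₂)                                       ≤⟨ ℕ.^-monoʳ-≤ X exponents ⟩
        X ^ (q ℕ.* E₁ ℕ.+ suc m)                             ≡⟨ ℕ.^-distribˡ-+-* X (q ℕ.* E₁) (suc m) ⟩
        X ^ (q ℕ.* E₁) ℕ.* X ^ suc m                         ≤⟨ ℕ.*-monoˡ-≤ (X ^ suc m) (bound^ q X′) ⟩
        c ^ q ℕ.* f X ^ q ℕ.* X ^ (q ℕ.* E₂) ℕ.* X ^ suc m   ≡⟨ swap (c ^ q ℕ.* f X ^ q) (X ^ (q ℕ.* E₂)) (X ^ suc m) ⟩
        c ^ q ℕ.* f X ^ q ℕ.* X ^ suc m ℕ.* X ^ (q ℕ.* E₂)   ∎)
      where
      open ℕ.≤-Reasoning
      X = suc X′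
      swap : ∀ a b c → a ℕ.* b ℕ.* c ≡ a ℕ.* c ℕ.* b
      swap = ℕ-Solver.solve-∀
      cancel : ∀ x y → (ℤ.- y ℤ.+ x) ℤ.+ y ≡ x
      cancel = ℤ-Solver.solve-∀
      exponents : q ℕ.* E₂ ℕ.≤ q ℕ.* E₁ ℕ.+ suc m
      exponents = ℤ.drop‿+≤+ (subst₂ ℤ._≤_ (cancel (+ (q ℕ.* E₂)) (+ suc m)) (sym (ℤ.pos-+ (q ℕ.* E₁) (suc m)))
                                            (ℤ.+-monoˡ-≤ (+ suc m) qE₂≤qE₁+m+1))

    ≫X^-intro : 1 ℕ.≤ c → (a : ℚ) → a + ⟦ E₂ ⟧ ≤ ⟦ E₁ ⟧ → f ≫X^ a
    ≫X^-intro 1≤c a a+E₂≤E₁ =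
      c ^ q , subst (ℕ._≤ c ^ q) (ℕ.^-zeroˡ q) (ℕ.^-monoˡ-≤ q 1≤c) ,
      powBound-from q (ℚ.numerator a) (numerator-bound a E₁ E₂ a+E₂≤E₁)
      where
      q = ℚ.denominatorℕ a

  rr≡⟦⟧ : ∀ k d r → (k ℕ.+ d) C d ≡ suc r → rr k d ≡ ⟦ r ⟧
  rr≡⟦⟧ k d r C≡1+r = begin-equality
    ⟦ (k ℕ.+ d) C d ⟧ - 1ℚ  ≡⟨ cong (λ n → ⟦ n ⟧ - 1ℚ) C≡1+r ⟩
    ⟦ suc r ⟧ - 1ℚ          ≡⟨ cong (_- 1ℚ) (⟦⟧-+ 1 r) ⟩
    1ℚ + ⟦ r ⟧ - 1ℚ         ≡⟨ solve 1 (λ x → con 1ℚ :+ x :- con 1ℚ := x) refl ⟦ r ⟧ ⟩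
    ⟦ r ⟧                   ∎
    where open ≤-Reasoning

  s-bound-ℕ : ∀ d k .{{_ : NonZero k}} r s (ν : ℚ) → (k ℕ.+ d) C d ≡ suc r →
    (+ (2 ℕ.* d)) / k < ν →
    ⟦ s ⟧ ≤ ((+ d) / suc (suc (2 ℕ.* d))) * (1ℚ - ν) * rr k d * ⟦ suc k ⟧ →
    s ℕ.* ((2 ℕ.+ 2 ℕ.* d) ℕ.* k) ℕ.+ 2 ℕ.* d ℕ.* (d ℕ.* r ℕ.* suc k) ℕ.≤ k ℕ.* (d ℕ.* r ℕ.* suc k)
  s-bound-ℕ d k r s ν C≡1+r 2d/k<ν s≤rr = ⟦⟧-cancel-≤ (begin
    ⟦ s ℕ.* (c ℕ.* k) ℕ.+ 2 ℕ.* d ℕ.* w ⟧              ≡⟨ trans (⟦⟧-+ (s ℕ.* (c ℕ.* k)) (2 ℕ.* d ℕ.* w)) (cong₂ _+_ (⟦⟧-* s (c ℕ.* k)) (⟦⟧-* (2 ℕ.* d) w)) ⟩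
    ⟦ s ⟧ * ⟦ c ℕ.* k ⟧ + ⟦ 2 ℕ.* d ⟧ * W              ≤⟨ +-monoˡ-≤ (⟦ 2 ℕ.* d ⟧ * W) (*-monoʳ-≤-⟦⟧ (c ℕ.* k) s≤) ⟩
    A * (1ℚ - ν) * ⟦ r ⟧ * ⟦ suc k ⟧ * ⟦ c ℕ.* k ⟧ + ⟦ 2 ℕ.* d ⟧ * W
      ≡⟨ cong (_+ ⟦ 2 ℕ.* d ⟧ * W) scaled ⟩
    (K - ν * K) * W + ⟦ 2 ℕ.* d ⟧ * W                 ≤⟨ +-monoˡ-≤ (⟦ 2 ℕ.* d ⟧ * W) (*-monoʳ-≤-⟦⟧ w (+-monoʳ-≤ K (neg-antimono-≤ 2d≤νk))) ⟩
    (K - ⟦ 2 ℕ.* d ⟧) * W + ⟦ 2 ℕ.* d ⟧ * W           ≡⟨ solve 3 (λ K t W → (K :- t) :* W :+ t :* W := K :* W) refl K ⟦ 2 ℕ.* d ⟧ W ⟩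
    K * W                                             ≡⟨ ⟦⟧-* k w ⟨
    ⟦ k ℕ.* w ⟧                                       ∎)
    where
    open ≤-Reasoning
    c = 2 ℕ.+ 2 ℕ.* d
    w = d ℕ.* r ℕ.* suc k
    A = (+ d) / suc (suc (2 ℕ.* d))
    K = ⟦ k ⟧
    W = ⟦ w ⟧
    s≤ : ⟦ s ⟧ ≤ A * (1ℚ - ν) * ⟦ r ⟧ * ⟦ suc k ⟧
    s≤ = subst (λ R → ⟦ s ⟧ ≤ A * (1ℚ - ν) * R * ⟦ suc k ⟧) (rr≡⟦⟧ k d r C≡1+r) s≤rr
    2d≤νk : ⟦ 2 ℕ.* d ⟧ ≤ ν * K
    2d≤νk = subst (_≤ ν * K) (/-*-⟦⟧ (2 ℕ.* d) k) (*-monoʳ-≤-⟦⟧ k (<⇒≤ 2d/k<ν))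
    scaled : A * (1ℚ - ν) * ⟦ r ⟧ * ⟦ suc k ⟧ * ⟦ c ℕ.* k ⟧ ≡ (K - ν * K) * W
    scaled = begin-equality
      A * (1ℚ - ν) * ⟦ r ⟧ * ⟦ suc k ⟧ * ⟦ c ℕ.* k ⟧         ≡⟨ cong (A * (1ℚ - ν) * ⟦ r ⟧ * ⟦ suc k ⟧ *_) (⟦⟧-* c k) ⟩
      A * (1ℚ - ν) * ⟦ r ⟧ * ⟦ suc k ⟧ * (⟦ c ⟧ * K)         ≡⟨ solve 6 (λ A ν R k₁ C K → A :* (con 1ℚ :- ν) :* R :* k₁ :* (C :* K) := A :* C :* ((K :- ν :* K) :* R :* k₁)) refl A ν ⟦ r ⟧ ⟦ suc k ⟧ ⟦ c ⟧ K ⟩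
      A * ⟦ c ⟧ * ((K - ν * K) * ⟦ r ⟧ * ⟦ suc k ⟧)          ≡⟨ cong (_* ((K - ν * K) * ⟦ r ⟧ * ⟦ suc k ⟧)) (/-*-⟦⟧ d (suc (suc (2 ℕ.* d)))) ⟩
      ⟦ d ⟧ * ((K - ν * K) * ⟦ r ⟧ * ⟦ suc k ⟧)              ≡⟨ solve 4 (λ D x R k₁ → D :* (x :* R :* k₁) := x :* (D :* R :* k₁)) refl ⟦ d ⟧ (K - ν * K) ⟦ r ⟧ ⟦ suc k ⟧ ⟩
      (K - ν * K) * (⟦ d ⟧ * ⟦ r ⟧ * ⟦ suc k ⟧)              ≡⟨ cong (λ x → (K - ν * K) * (x * ⟦ suc k ⟧)) (⟦⟧-* d r) ⟨
      (K - ν * K) * (⟦ d ℕ.* r ⟧ * ⟦ suc k ⟧)                ≡⟨ cong ((K - ν * K) *_) (⟦⟧-* (d ℕ.* r) (suc k)) ⟨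
      (K - ν * K) * W                                       ∎

  exponent-bound-ℚ : ∀ D k .{{_ : NonZero k}} L r s → let d = suc D ; P = suc d ℕ.* k in .{{_ : NonZero P}} →
    (k ℕ.+ d) C d ≡ suc r →
    s ℕ.* ((2 ℕ.+ 2 ℕ.* d) ℕ.* k) ℕ.+ 1 ℕ.+ suc d ℕ.* (k ℕ.* k) ℕ.* L ℕ.≤ d ℕ.* suc r ℕ.* (k ℕ.* k) →
    ⟦ 2 ℕ.* s ℕ.* d ⟧ - KK k d + (+ 1) / P + ⟦ k ℕ.* L ⟧ ≤ ⟦ D ℕ.* s ℕ.+ D ℕ.* s ⟧
  exponent-bound-ℚ D k L r s C≡1+r gap = *-cancelʳ-≤-pos ⟦ P ⟧ {{⟦⟧-pos P}} (begin
    (X - B * (R + 1ℚ) * K + η + L′) * ⟦ P ⟧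
       ≡⟨ solve 7 (λ X B R K η L′ P → (X :- B :* (R :+ con 1ℚ) :* K :+ η :+ L′) :* P := X :* P :+ η :* P :+ L′ :* P :- B :* (R :+ con 1ℚ) :* K :* P)
                refl X B R K η L′ ⟦ P ⟧ ⟩
    X * ⟦ P ⟧ + η * ⟦ P ⟧ + L′ * ⟦ P ⟧ - B * (R + 1ℚ) * K * ⟦ P ⟧
       ≡⟨ cong₂ (λ u v → X * ⟦ P ⟧ + u + L′ * ⟦ P ⟧ - v) (/-*-⟦⟧ 1 P) K-terms ⟩
    X * ⟦ P ⟧ + 1ℚ + L′ * ⟦ P ⟧ - ⟦ d ⟧ * ⟦ suc r ⟧ * (K * K)
       ≤⟨ +-monoˡ-≤ (- (⟦ d ⟧ * ⟦ suc r ⟧ * (K * K))) cast ⟩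
    E * ⟦ P ⟧ + ⟦ d ⟧ * ⟦ suc r ⟧ * (K * K) - ⟦ d ⟧ * ⟦ suc r ⟧ * (K * K)
       ≡⟨ solve 2 (λ Z Y → (Z :+ Y) :- Y := Z) refl (E * ⟦ P ⟧) (⟦ d ⟧ * ⟦ suc r ⟧ * (K * K)) ⟩
    E * ⟦ P ⟧ ∎)
    where
    open ≤-Reasoning
    d = suc D
    P = suc d ℕ.* k
    X = ⟦ 2 ℕ.* s ℕ.* d ⟧
    B = (+ d) / suc d
    R = rr k d
    K = ⟦ k ⟧
    η = (+ 1) / P
    L′ = ⟦ k ℕ.* L ⟧
    E = ⟦ D ℕ.* s ℕ.+ D ℕ.* s ⟧
    R+1≡ : R + 1ℚ ≡ ⟦ suc r ⟧
    R+1≡ = trans (cong (_+ 1ℚ) (rr≡⟦⟧ k d r C≡1+r)) (trans (+-comm ⟦ r ⟧ 1ℚ) (sym (⟦⟧-+ 1 r)))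
    nat : 2 ℕ.* s ℕ.* d ℕ.* P ℕ.+ 1 ℕ.+ k ℕ.* L ℕ.* P ℕ.≤ (D ℕ.* s ℕ.+ D ℕ.* s) ℕ.* P ℕ.+ d ℕ.* suc r ℕ.* (k ℕ.* k)
    nat = subst (ℕ._≤ (D ℕ.* s ℕ.+ D ℕ.* s) ℕ.* P ℕ.+ d ℕ.* suc r ℕ.* (k ℕ.* k)) (regroup D s k L)
                (ℕ.+-monoʳ-≤ ((D ℕ.* s ℕ.+ D ℕ.* s) ℕ.* P) gap)
      where
      regroup : ∀ D s k L → (D ℕ.* s ℕ.+ D ℕ.* s) ℕ.* (suc (suc D) ℕ.* k) ℕ.+ (s ℕ.* ((2 ℕ.+ 2 ℕ.* suc D) ℕ.* k) ℕ.+ 1 ℕ.+ suc (suc D) ℕ.* (k ℕ.* k) ℕ.* L)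
                              ≡ 2 ℕ.* s ℕ.* suc D ℕ.* (suc (suc D) ℕ.* k) ℕ.+ 1 ℕ.+ k ℕ.* L ℕ.* (suc (suc D) ℕ.* k)
      regroup = ℕ-Solver.solve-∀
    K-terms : B * (R + 1ℚ) * K * ⟦ P ⟧ ≡ ⟦ d ⟧ * ⟦ suc r ⟧ * (K * K)
    K-terms = begin-equality
      B * (R + 1ℚ) * K * ⟦ P ⟧              ≡⟨ cong (B * (R + 1ℚ) * K *_) (⟦⟧-* (suc d) k) ⟩
      B * (R + 1ℚ) * K * (⟦ suc d ⟧ * K)    ≡⟨ solve 4 (λ B C K M → B :* C :* K :* (M :* K) := B :* M :* C :* (K :* K)) refl B (R + 1ℚ) K ⟦ suc d ⟧ ⟩
      B * ⟦ suc d ⟧ * (R + 1ℚ) * (K * K)    ≡⟨ cong₂ (λ u v → u * v * (K * K)) (/-*-⟦⟧ d (suc d)) R+1≡ ⟩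
      ⟦ d ⟧ * ⟦ suc r ⟧ * (K * K)           ∎
    cast : X * ⟦ P ⟧ + 1ℚ + L′ * ⟦ P ⟧ ≤ E * ⟦ P ⟧ + ⟦ d ⟧ * ⟦ suc r ⟧ * (K * K)
    cast = subst₂ _≤_ castˡ castʳ (⟦⟧-mono-≤ nat)
      where
      castˡ : ⟦ 2 ℕ.* s ℕ.* d ℕ.* P ℕ.+ 1 ℕ.+ k ℕ.* L ℕ.* P ⟧ ≡ X * ⟦ P ⟧ + 1ℚ + L′ * ⟦ P ⟧
      castˡ = trans (⟦⟧-+ (2 ℕ.* s ℕ.* d ℕ.* P ℕ.+ 1) (k ℕ.* L ℕ.* P))
                    (cong₂ _+_ (trans (⟦⟧-+ (2 ℕ.* s ℕ.* d ℕ.* P) 1) (cong (_+ 1ℚ) (⟦⟧-* (2 ℕ.* s ℕ.* d) P))) (⟦⟧-* (k ℕ.* L) P))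
      castʳ : ⟦ (D ℕ.* s ℕ.+ D ℕ.* s) ℕ.* P ℕ.+ d ℕ.* suc r ℕ.* (k ℕ.* k) ⟧ ≡ E * ⟦ P ⟧ + ⟦ d ⟧ * ⟦ suc r ⟧ * (K * K)
      castʳ = trans (⟦⟧-+ ((D ℕ.* s ℕ.+ D ℕ.* s) ℕ.* P) (d ℕ.* suc r ℕ.* (k ℕ.* k)))
                    (cong₂ _+_ (⟦⟧-* (D ℕ.* s ℕ.+ D ℕ.* s) P)
                               (trans (⟦⟧-* (d ℕ.* suc r) (k ℕ.* k)) (cong₂ _*_ (⟦⟧-* d (suc r)) (⟦⟧-* k k))))

open Counting using (J-lower-bound; binomial-suc)
open ExponentArithmetic using (exponent-bound-ℕ)
open RationalBounds using (≫X^-intro; s-bound-ℕ; exponent-bound-ℚ; 0<1/n)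
import Data.Nat as ℕ
import Data.Nat.Properties as ℕ
open import Data.List using (length)
open import Data.Nat using (ℕ; zero; suc; _≤_; NonZero) renaming (_*_ to _*ℕ_)
open import Data.Integer using (+_)
open import Data.Rational using (ℚ; _/_; _<_; _+_; _-_; _*_; 0ℚ; 1ℚ) renaming (_≤_ to _≤ℚ_)
open import Data.Product using (Σ; _×_; _,_)
open import Relation.Binary.PropositionalEquality using (refl)

theorem3p2 : (d k : ℕ) → .{{_ : NonZero k}} → 1 ≤ d →
    Σ ℚ λ η → (0ℚ < η) ×
      ((ν : ℚ) (s : ℕ) → ((+ (2 *ℕ d)) / k) < ν → ν < 1ℚ →
        ⟦ s ⟧ ≤ℚ ((+ d) / suc (suc (2 *ℕ d))) * (1ℚ - ν) * rr k d * ⟦ suc k ⟧ →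
        (λ X → J s k d X) ≫X^ (⟦ 2 *ℕ s *ℕ d ⟧ - KK k d + η))
theorem3p2 zero    _         ()
theorem3p2 (suc D) k@(suc _) _ with binomial-suc k D
... | r , C≡1+r , binomial = η , 0<1/n P , λ ν s 2d/k<ν _ s≤ →
  ≫X^-intro (J s k (suc D)) (suc s ℕ.^ L) (D ℕ.* s ℕ.+ D ℕ.* s) (k ℕ.* L) (J-lower-bound s k D) (ℕ.m^n>0 (suc s) L)
    (⟦ 2 *ℕ s *ℕ suc D ⟧ - KK k (suc D) + η)
    (exponent-bound-ℚ D k L r s C≡1+r
      (exponent-bound-ℕ D k L r s (ℕ.s≤s ℕ.z≤n) binomial (λ { refl → refl })
        (s-bound-ℕ (suc D) k r s ν C≡1+r 2d/k<ν s≤)))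
  where
  P = suc (suc D) *ℕ k
  η = (+ 1) / P
  L = length (multiIndices k D)
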